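{- Every constrained Young tableau of size $2\times m$ is realizable.
   Context: A tableau of size $2\times m$ is a map $T:[2]\times[m]\to\mathbb{Z}_{>0}$ whose set of values is $\{1,\dots,K\}$ for some $K$. It is a constrained Young tableau if it is weakly increasing along rows and columns and satisfies: (i) if $T(i,j)=T(i,j+1)$ for some $i\in[2]$ then $T(i',j)=T(i',j+1)$ for all $i'\in[2]$; (ii) if $T(1,j)=T(2,j)$ for some $j\in[m]$ then $T(1,j')=T(2,j')$ for all $j'\in[m]$. It is realizable if there exist reals $0=a_1\leq a_2$ and $0=b_1\leq b_2\leq\cdots\leq b_m$ such that for all cells, $T(i,j)\leq T(i',j')$ if and only if $a_i+b_j\leq a_{i'}+b_{j'}$ (i.e. $T$ records the relative order, with ties, of the values $a_i+b_j$, the smallest value receiving $1$); equivalently $T$ is the tableau of relative orders of the values of the linear functional $(\mathbf{a},\mathbf{b})$ on the vertices $\mathbf{e}_i\times\mathbf{e}_j$ of $\Delta_1\times\Delta_{m-1}$. -}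

module Defs where

open import Data.Nat as ℕ using (ℕ; zero; suc)
open import Data.Fin using (Fin; zero; suc; toℕ)
open import Data.Product using (Σ; ∃; ∃-syntax; _×_; _,_)
open import Relation.Binary.PropositionalEquality using (_≡_)
open import Function.Bundles using (_⇔_)
open import Data.Rational as ℚ using (ℚ; 0ℚ)

-- A 2 × m tableau: rows indexed by Fin 2 (row 1 = zero, row 2 = suc zero),
-- columns by Fin m (column 1 = index with toℕ ≡ 0).
Tableau : ℕ → Set
Tableau m = Fin 2 → Fin m → ℕ

ValuesInitialSegment : ∀ {m} → Tableau m → Set
ValuesInitialSegment {m} T =
  ∃[ K ] ((∀ i j → (1 ℕ.≤ T i j) × (T i j ℕ.≤ K))
         × (∀ k → 1 ℕ.≤ k → k ℕ.≤ K → ∃[ i ] ∃[ j ] (T i j ≡ k)))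

IsConstrainedYoung : ∀ {m} → Tableau m → Set
IsConstrainedYoung {m} T =
  ValuesInitialSegment T
  × (∀ i (j j' : Fin m) → toℕ j ℕ.≤ toℕ j' → T i j ℕ.≤ T i j')
  × (∀ (j : Fin m) → T zero j ℕ.≤ T (suc zero) j)
  × (∀ i i' (j j' : Fin m) → suc (toℕ j) ≡ toℕ j' →
       T i j ≡ T i j' → T i' j ≡ T i' j')
  × (∀ (j j' : Fin m) → T zero j ≡ T (suc zero) j →
       T zero j' ≡ T (suc zero) j')

IsRealizable : ∀ {m} → Tableau m → Set
IsRealizable {m} T =
  Σ (Fin 2 → ℚ) λ a → Σ (Fin m → ℚ) λ b →
    (a zero ≡ 0ℚ)
    × (a zero ℚ.≤ a (suc zero))
    × (∀ (j : Fin m) → toℕ j ≡ 0 → b j ≡ 0ℚ)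
    × (∀ (j j' : Fin m) → toℕ j ℕ.≤ toℕ j' → b j ℚ.≤ b j')
    × (∀ i j i' j' → (T i j ℕ.≤ T i' j') ⇔ (a i ℚ.+ b j ℚ.≤ a i' ℚ.+ b j'))

{-# OPTIONS --safe #-}
-- Fix a = (0, 1) and build b column by column from the right. Prepending a
-- column j whose row-1 entry ties with column j+1 forces, by condition (i),
-- a copy of b_{j+1}. Otherwise the row-1 entry of column j is the strict
-- minimum of the tableau from column j on, and only the row-2 entry
-- 1 + b_j needs placing among the row-1 values b_k (k > j): either it ties
-- with one of them, or it goes into the gap between those below and those
-- above it, which is nonempty because ℚ is dense. A tableau with equal rows
-- is reduced to this case by realizing the strict tableau with rows 2x and
-- 2x + 1 and then taking a = (0, 0).
module Submission where

open import Defs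
open import Data.Nat as ℕ using (ℕ; zero; suc; _<_; _≤_; s≤s; z≤n)
import Data.Nat.Properties as ℕP
open import Data.Fin using (Fin; zero; suc; toℕ)
import Data.Fin.Properties as FinP
open import Data.Vec.Functional using (_∷_)
open import Data.Product using (∃; ∃-syntax; _×_; _,_; proj₁; proj₂)
open import Data.Sum using (inj₁; inj₂; [_,_]′)
open import Relation.Binary.PropositionalEquality
open import Relation.Nullary using (yes; no)
open import Data.Empty using (⊥-elim)
open import Function.Base using (_∘_)
open import Function.Bundles using (_⇔_; mk⇔)
open import Data.Rational as ℚ using (ℚ; 0ℚ; 1ℚ)
import Data.Rational.Properties as ℚP
open import Data.Rational.Solver using (module +-*-Solver)
open +-*-Solver using (solve; _:+_; _:-_; :-_; _:=_; con)

+-cancelˡ-≤ : ∀ r {p q} → r ℚ.+ p ℚ.≤ r ℚ.+ q → p ℚ.≤ q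
+-cancelˡ-≤ r {p} {q} h =
  subst₂ ℚ._≤_ (-r+[r+p]≡p r p) (-r+[r+p]≡p r q) (ℚP.+-monoʳ-≤ (ℚ.- r) h)
  where
  -r+[r+p]≡p : ∀ r p → ℚ.- r ℚ.+ (r ℚ.+ p) ≡ p
  -r+[r+p]≡p = solve 2 (λ r p → (:- r) :+ (r :+ p) := p) refl

p-1<p : ∀ p → p ℚ.- 1ℚ ℚ.< p
p-1<p p = subst (p ℚ.- 1ℚ ℚ.<_) (ℚP.+-identityʳ p)
            (ℚP.+-monoʳ-< p (ℚP.negative⁻¹ (ℚ.- 1ℚ)))

<1+⇒-1< : ∀ {c p} → c ℚ.< 1ℚ ℚ.+ p → c ℚ.- 1ℚ ℚ.< p
<1+⇒-1< {c} {p} c<1+p =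
  subst (c ℚ.- 1ℚ ℚ.<_) ([1+p]-1≡p p) (ℚP.+-monoˡ-< (ℚ.- 1ℚ) c<1+p)
  where
  [1+p]-1≡p : ∀ p → 1ℚ ℚ.+ p ℚ.- 1ℚ ≡ p
  [1+p]-1≡p = solve 1 (λ p → con 1ℚ :+ p :- con 1ℚ := p) refl

1+[c-1]≡c : ∀ c → 1ℚ ℚ.+ (c ℚ.- 1ℚ) ≡ c
1+[c-1]≡c = solve 1 (λ c → con 1ℚ :+ (c :- con 1ℚ) := c) refl

⊔-<-lub : ∀ {p q r} → p ℚ.< r → q ℚ.< r → p ℚ.⊔ q ℚ.< r
⊔-<-lub {p} {q} {r} p<r q<r =
  [ (λ e → subst (ℚ._< r) (sym e) p<r) , (λ e → subst (ℚ._< r) (sym e) q<r) ]′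
  (ℚP.⊔-sel p q)

⊓-<-glb : ∀ {p q r} → r ℚ.< p → r ℚ.< q → r ℚ.< p ℚ.⊓ q
⊓-<-glb {p} {q} {r} r<p r<q =
  [ (λ e → subst (r ℚ.<_) (sym e) r<p) , (λ e → subst (r ℚ.<_) (sym e) r<q) ]′
  (ℚP.⊓-sel p q)

SameOrder : ℕ → ℕ → ℚ → ℚ → Set
SameOrder p q r s = (p < q → r ℚ.< s) × (p ≡ q → r ≡ s) × (q < p → s ℚ.< r)

SameOrder-refl : ∀ p r → SameOrder p p r r
SameOrder-refl p r =
  (λ p<p → ⊥-elim (ℕP.<-irrefl refl p<p)) , (λ _ → refl) ,
  (λ p<p → ⊥-elim (ℕP.<-irrefl refl p<p))

SameOrder-sym : ∀ {p q r s} → SameOrder p q r s → SameOrder q p s r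
SameOrder-sym (lt , eq , gt) = gt , (λ e → sym (eq (sym e))) , lt

SameOrder-< : ∀ {p q r s} → p < q → r ℚ.< s → SameOrder p q r s
SameOrder-< p<q r<s =
  (λ _ → r<s) , (λ e → ⊥-elim (ℕP.<-irrefl e p<q)) ,
  (λ q<p → ⊥-elim (ℕP.<-asym p<q q<p))

SameOrder-cong : ∀ {p q r s p' q' r' s'} → p ≡ p' → q ≡ q' → r ≡ r' → s ≡ s' →
                 SameOrder p q r s → SameOrder p' q' r' s'
SameOrder-cong refl refl refl refl o = o

SameOrder-+ʳ : ∀ {p q r s} t → SameOrder p q r s →
               SameOrder p q (r ℚ.+ t) (s ℚ.+ t)
SameOrder-+ʳ t (lt , eq , gt) =
  (λ h → ℚP.+-monoˡ-< t (lt h)) , (λ h → cong (ℚ._+ t) (eq h)) ,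
  (λ h → ℚP.+-monoˡ-< t (gt h))

SameOrder-reflect : ∀ (f : ℕ → ℕ) → (∀ {p q} → p < q → f p < f q) →
                    ∀ {p q r s} → SameOrder (f p) (f q) r s → SameOrder p q r s
SameOrder-reflect f f-mono (lt , eq , gt) =
  (λ h → lt (f-mono h)) , (λ h → eq (cong f h)) , (λ h → gt (f-mono h))

SameOrder⇒≤ : ∀ {p q r s} → SameOrder p q r s → p ≤ q → r ℚ.≤ s
SameOrder⇒≤ {p} {q} (lt , eq , _) p≤q with ℕP.m≤n⇒m<n∨m≡n p≤q
... | inj₁ p<q = ℚP.<⇒≤ (lt p<q)
... | inj₂ p≡q = ℚP.≤-reflexive (eq p≡q)

SameOrder⇒⇔ : ∀ {p q r s} → SameOrder p q r s → (p ≤ q) ⇔ (r ℚ.≤ s)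
SameOrder⇒⇔ {p} {q} {r} {s} o@(_ , _ , gt) = mk⇔ (SameOrder⇒≤ o) from
  where
  from : r ℚ.≤ s → p ≤ q
  from r≤s with p ℕ.≤? q
  ... | yes p≤q = p≤q
  ... | no p≰q = ⊥-elim (ℚP.<-irrefl refl (ℚP.<-≤-trans (gt (ℕP.≰⇒> p≰q)) r≤s))

OrderAgrees : ∀ {n} → (Fin n → ℕ) → (Fin n → ℚ) → Set
OrderAgrees x r = ∀ k k' → SameOrder (x k) (x k') (r k) (r k')

∃-strictLowerBound : ∀ {n} (r : Fin n → ℚ) u → ∃[ l ] l ℚ.< u × (∀ k → l ℚ.< r k)
∃-strictLowerBound {zero} r u = u ℚ.- 1ℚ , p-1<p u , λ ()
∃-strictLowerBound {suc n} r u
  with l , l<u , l<r ← ∃-strictLowerBound (r ∘ suc) u =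
  l ℚ.⊓ (r zero ℚ.- 1ℚ) ,
  ℚP.≤-<-trans (ℚP.p⊓q≤p l _) l<u ,
  λ { zero    → ℚP.≤-<-trans (ℚP.p⊓q≤q l _) (p-1<p (r zero))
    ; (suc k) → ℚP.≤-<-trans (ℚP.p⊓q≤p l _) (l<r k) }

-- Induction on the family: each element below (above) y raises l (lowers u).
interpolate : ∀ {n} (x : Fin n → ℕ) (r : Fin n → ℚ) → OrderAgrees x r →
              ∀ y {l u} → l ℚ.< u →
              (∀ k → x k < y → r k ℚ.< u) → (∀ k → y < x k → l ℚ.< r k) →
              ∃[ c ] l ℚ.< c × c ℚ.< u ×
                (∀ k → (x k < y → r k ℚ.< c) × (y < x k → c ℚ.< r k))
interpolate {zero} x r agree y l<u below above
  with c , l<c , c<u ← ℚP.<-dense l<u = c , l<c , c<u , λ ()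
interpolate {suc n} x r agree y {l} {u} l<u below above
  with x zero ℕ.<? y | y ℕ.<? x zero
... | yes x₀<y | _ =
  let c , l⊔r₀<c , c<u , sep =
        interpolate (x ∘ suc) (r ∘ suc) (λ k k' → agree (suc k) (suc k')) y
          (⊔-<-lub l<u (below zero x₀<y)) (λ k → below (suc k))
          (λ k y<x → ⊔-<-lub (above (suc k) y<x)
                             (proj₁ (agree zero (suc k)) (ℕP.<-trans x₀<y y<x)))
      l<c  = ℚP.≤-<-trans (ℚP.p≤p⊔q l (r zero)) l⊔r₀<c
      r₀<c = ℚP.≤-<-trans (ℚP.p≤q⊔p l (r zero)) l⊔r₀<c
  in c , l<c , c<u ,
     λ { zero    → (λ _ → r₀<c) , (λ y<x₀ → ⊥-elim (ℕP.<-asym x₀<y y<x₀))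
       ; (suc k) → sep k }
... | no _ | yes y<x₀ =
  let c , l<c , c<u⊓r₀ , sep =
        interpolate (x ∘ suc) (r ∘ suc) (λ k k' → agree (suc k) (suc k')) y
          (⊓-<-glb l<u (above zero y<x₀))
          (λ k x<y → ⊓-<-glb (below (suc k) x<y)
                             (proj₁ (agree (suc k) zero) (ℕP.<-trans x<y y<x₀)))
          (λ k → above (suc k))
      c<u  = ℚP.<-≤-trans c<u⊓r₀ (ℚP.p⊓q≤p u (r zero))
      c<r₀ = ℚP.<-≤-trans c<u⊓r₀ (ℚP.p⊓q≤q u (r zero))
  in c , l<c , c<u ,
     λ { zero    → (λ x₀<y → ⊥-elim (ℕP.<-asym x₀<y y<x₀)) , (λ _ → c<r₀)
       ; (suc k) → sep k }
... | no x₀≮y | no y≮x₀ =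
  let c , l<c , c<u , sep =
        interpolate (x ∘ suc) (r ∘ suc) (λ k k' → agree (suc k) (suc k')) y
          l<u (λ k → below (suc k)) (λ k → above (suc k))
  in c , l<c , c<u ,
     λ { zero    → (λ x₀<y → ⊥-elim (x₀≮y x₀<y)) , (λ y<x₀ → ⊥-elim (y≮x₀ y<x₀))
       ; (suc k) → sep k }

extendOrder : ∀ {n} (x : Fin n → ℕ) (r : Fin n → ℚ) → OrderAgrees x r →
              ∀ y u → (∀ k → x k ≤ y → r k ℚ.< u) →
              ∃[ c ] c ℚ.< u × (∀ k → SameOrder y (x k) c (r k))
extendOrder x r agree y u below with FinP.any? (λ k → x k ℕ.≟ y)
... | yes (k₀ , x₀≡y) =
  r k₀ , below k₀ (ℕP.≤-reflexive x₀≡y) ,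
  λ k → SameOrder-cong x₀≡y refl refl refl (agree k₀ k)
... | no y∉x =
  let l , l<u , l<r = ∃-strictLowerBound r u
      c , _ , c<u , sep = interpolate x r agree y l<u
                            (λ k x<y → below k (ℕP.<⇒≤ x<y)) (λ k _ → l<r k)
  in c , c<u ,
     λ k → (λ y<x → proj₂ (sep k) y<x) ,
           (λ y≡x → ⊥-elim (y∉x (k , sym y≡x))) ,
           (λ x<y → proj₁ (sep k) x<y)

RowMonotone : ∀ {m} → Tableau m → Set
RowMonotone {m} T = ∀ i (j j' : Fin m) → toℕ j ≤ toℕ j' → T i j ≤ T i j'

StrictColumns : ∀ {m} → Tableau m → Set
StrictColumns {m} T = ∀ (j : Fin m) → T zero j < T (suc zero) j

AdjacentTiesShared : ∀ {m} → Tableau m → Set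
AdjacentTiesShared {m} T =
  ∀ i i' (j j' : Fin m) → suc (toℕ j) ≡ toℕ j' → T i j ≡ T i j' → T i' j ≡ T i' j'

Realizes : ∀ {m} → Tableau m → (Fin 2 → ℚ) → (Fin m → ℚ) → Set
Realizes T a b =
  ∀ i j i' j' → SameOrder (T i j) (T i' j') (a i ℚ.+ b j) (a i' ℚ.+ b j')

dropColumn : ∀ {m} → Tableau (suc m) → Tableau m
dropColumn T i j = T i (suc j)

unitGap : Fin 2 → ℚ
unitGap zero       = 0ℚ
unitGap (suc zero) = 1ℚ

realizes-∷ : ∀ {m} {T : Tableau (suc m)} a b β →
             Realizes (dropColumn T) a b →
             (∀ i i' → SameOrder (T i zero) (T i' zero) (a i ℚ.+ β) (a i' ℚ.+ β)) →
             (∀ i i' k → SameOrder (T i zero) (T i' (suc k)) (a i ℚ.+ β) (a i' ℚ.+ b k)) →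
             Realizes T a (β ∷ b)
realizes-∷ a b β rest first cross i zero    i' zero     = first i i'
realizes-∷ a b β rest first cross i zero    i' (suc k)  = cross i i' k
realizes-∷ a b β rest first cross i (suc k) i' zero     = SameOrder-sym (cross i' i k)
realizes-∷ a b β rest first cross i (suc k) i' (suc k') = rest i k i' k'

realizes-strictColumn : ∀ (t : Fin 2 → ℕ) → t zero < t (suc zero) → ∀ β i i' →
                        SameOrder (t i) (t i') (unitGap i ℚ.+ β) (unitGap i' ℚ.+ β)
realizes-strictColumn t t₀<t₁ β zero       zero       = SameOrder-refl _ _
realizes-strictColumn t t₀<t₁ β zero       (suc zero) =
  SameOrder-< t₀<t₁ (ℚP.+-monoˡ-< β (ℚP.positive⁻¹ 1ℚ))
realizes-strictColumn t t₀<t₁ β (suc zero) zero       =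
  SameOrder-sym (realizes-strictColumn t t₀<t₁ β zero (suc zero))
realizes-strictColumn t t₀<t₁ β (suc zero) (suc zero) = SameOrder-refl _ _

unitGap-nonNeg : ∀ i → 0ℚ ℚ.≤ unitGap i
unitGap-nonNeg zero       = ℚP.≤-refl
unitGap-nonNeg (suc zero) = ℚP.<⇒≤ (ℚP.positive⁻¹ 1ℚ)

module PrependColumn {n} (T : Tableau (suc (suc n))) (mono : RowMonotone T)
                     (strict : StrictColumns T) (ties : AdjacentTiesShared T)
                     {b : Fin (suc n) → ℚ}
                     (realizesRest : Realizes (dropColumn T) unitGap b) where

  T₀₁≤T : ∀ i k → T zero (suc zero) ≤ T i (suc k)
  T₀₁≤T zero       k = mono zero (suc zero) (suc k) (s≤s z≤n)
  T₀₁≤T (suc zero) k = ℕP.≤-trans (T₀₁≤T zero k) (ℕP.<⇒≤ (strict (suc k)))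

  b₀≤b : ∀ k → b zero ℚ.≤ b k
  b₀≤b k = +-cancelˡ-≤ 0ℚ (SameOrder⇒≤ (realizesRest zero zero zero k) (T₀₁≤T zero k))

  tiedColumn : T zero zero ≡ T zero (suc zero) → Realizes T unitGap (b zero ∷ b)
  tiedColumn tie = realizes-∷ unitGap b (b zero) realizesRest
    (λ i i' → SameOrder-cong (sym (copy i)) (sym (copy i')) refl refl
                (realizesRest i zero i' zero))
    (λ i i' k → SameOrder-cong (sym (copy i)) refl refl refl (realizesRest i zero i' k))
    where
    copy : ∀ i → T i zero ≡ T i (suc zero)
    copy zero       = tie
    copy (suc zero) = ties zero (suc zero) zero (suc zero) refl tie

  module _ (T₀₀<T₀₁ : T zero zero < T zero (suc zero)) where

    T₁₀<T₁₁ : T (suc zero) zero < T (suc zero) (suc zero)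
    T₁₀<T₁₁ = ℕP.≤∧≢⇒< (mono (suc zero) zero (suc zero) z≤n)
                (λ tie → ℕP.<⇒≢ T₀₀<T₀₁ (ties (suc zero) zero zero (suc zero) refl tie))

    placeT₁₀ : ∃[ c ] c ℚ.< 1ℚ ℚ.+ b zero ×
                 (∀ k → SameOrder (T (suc zero) zero) (T zero (suc k)) c (0ℚ ℚ.+ b k))
    placeT₁₀ = extendOrder (λ k → T zero (suc k)) (λ k → 0ℚ ℚ.+ b k)
                 (λ k k' → realizesRest zero k zero k') (T (suc zero) zero) (1ℚ ℚ.+ b zero)
                 (λ k T₀ₖ≤T₁₀ → proj₁ (realizesRest zero k (suc zero) zero)
                                  (ℕP.≤-<-trans T₀ₖ≤T₁₀ T₁₀<T₁₁))

    strictColumn : ∃ (Realizes T unitGap)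
    strictColumn = β ∷ b ,
      realizes-∷ unitGap b β realizesRest
        (realizes-strictColumn (λ i → T i zero) (strict zero) β) cross
      where
      c : ℚ
      c = proj₁ placeT₁₀

      β : ℚ
      β = c ℚ.- 1ℚ

      β<b : ∀ k → β ℚ.< b k
      β<b k = ℚP.<-≤-trans (<1+⇒-1< (proj₁ (proj₂ placeT₁₀))) (b₀≤b k)

      cross : ∀ i i' k → SameOrder (T i zero) (T i' (suc k))
                                   (unitGap i ℚ.+ β) (unitGap i' ℚ.+ b k)
      cross zero i' k = SameOrder-< (ℕP.<-≤-trans T₀₀<T₀₁ (T₀₁≤T i' k))
        (ℚP.<-≤-trans (ℚP.+-monoʳ-< 0ℚ (β<b k)) (ℚP.+-monoˡ-≤ (b k) (unitGap-nonNeg i')))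
      cross (suc zero) zero k =
        SameOrder-cong refl refl (sym (1+[c-1]≡c c)) refl (proj₂ (proj₂ placeT₁₀) k)
      cross (suc zero) (suc zero) k =
        SameOrder-< (ℕP.<-≤-trans T₁₀<T₁₁ (mono (suc zero) (suc zero) (suc k) (s≤s z≤n)))
                    (ℚP.+-monoʳ-< 1ℚ (β<b k))

realizeStrict : ∀ {m} (T : Tableau m) → RowMonotone T → StrictColumns T →
                AdjacentTiesShared T → ∃ (Realizes T unitGap)
realizeStrict {zero} T _ _ _ = (λ ()) , λ _ ()
realizeStrict {suc zero} T _ strict _ =
  (λ _ → 0ℚ) ,
  λ { i zero i' zero → realizes-strictColumn (λ i → T i zero) (strict zero) 0ℚ i i' }
realizeStrict {suc (suc n)} T mono strict ties
  with b , realizesRest ← realizeStrict (dropColumn T)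
                             (λ i j j' j≤j' → mono i (suc j) (suc j') (s≤s j≤j'))
                             (λ j → strict (suc j))
                             (λ i i' j j' adjacent → ties i i' (suc j) (suc j') (cong suc adjacent))
  with T zero zero ℕ.≟ T zero (suc zero)
... | yes tie = b zero ∷ b , PrependColumn.tiedColumn T mono strict ties realizesRest tie
... | no ¬tie = PrependColumn.strictColumn T mono strict ties realizesRest
                  (ℕP.≤∧≢⇒< (mono zero zero (suc zero) z≤n) ¬tie)

doubled : ∀ {m} → Tableau m → Tableau m
doubled T i j = toℕ i ℕ.+ 2 ℕ.* T zero j

realizeEqualRows : ∀ {m} (T : Tableau m) → RowMonotone T →
                   (∀ j → T zero j ≡ T (suc zero) j) → ∃ (Realizes T (λ _ → 0ℚ))
realizeEqualRows T mono rowsEqual =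
  let b , realizesDoubled = realizeStrict (doubled T) mono² strict² ties²
  in b , λ i j i' j' →
       SameOrder-cong (rowOf i j) (rowOf i' j') refl refl
         (SameOrder-reflect (2 ℕ.*_) (ℕP.*-monoʳ-< 2) {T zero j} {T zero j'}
           (realizesDoubled zero j zero j'))
  where
  rowOf : ∀ i j → T zero j ≡ T i j
  rowOf zero       j = refl
  rowOf (suc zero) j = rowsEqual j

  mono² : RowMonotone (doubled T)
  mono² i j j' j≤j' = ℕP.+-monoʳ-≤ (toℕ i) (ℕP.*-monoʳ-≤ 2 (mono zero j j' j≤j'))

  strict² : StrictColumns (doubled T)
  strict² j = ℕP.n<1+n (2 ℕ.* T zero j)

  ties² : AdjacentTiesShared (doubled T)
  ties² i i' j j' _ tie =
    cong (λ v → toℕ i' ℕ.+ 2 ℕ.* v)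
      (ℕP.*-cancelˡ-≡ (T zero j) (T zero j') 2 (ℕP.+-cancelˡ-≡ (toℕ i) _ _ tie))

realizable : ∀ {n} {T : Tableau (suc n)} a b → a zero ≡ 0ℚ → a zero ℚ.≤ a (suc zero) →
             RowMonotone T → Realizes T a b → IsRealizable T
realizable {T = T} a b a₀≡0 a₀≤a₁ mono realizes =
  a , b' , a₀≡0 , a₀≤a₁ , b'₀≡0 , b'-mono , order
  where
  b' : Fin (suc _) → ℚ
  b' j = b j ℚ.- b zero

  b'₀≡0 : ∀ j → toℕ j ≡ 0 → b' j ≡ 0ℚ
  b'₀≡0 zero _ = ℚP.+-inverseʳ (b zero)

  b'-mono : ∀ j j' → toℕ j ≤ toℕ j' → b' j ℚ.≤ b' j'
  b'-mono j j' j≤j' = ℚP.+-monoˡ-≤ (ℚ.- b zero)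
    (+-cancelˡ-≤ (a zero) (SameOrder⇒≤ (realizes zero j zero j') (mono zero j j' j≤j')))

  order : ∀ i j i' j' → (T i j ≤ T i' j') ⇔ (a i ℚ.+ b' j ℚ.≤ a i' ℚ.+ b' j')
  order i j i' j' = SameOrder⇒⇔
    (SameOrder-cong refl refl (ℚP.+-assoc (a i) (b j) _) (ℚP.+-assoc (a i') (b j') _)
      (SameOrder-+ʳ (ℚ.- b zero) (realizes i j i' j')))

-- The values-form-{1, …, K} condition is not needed: only the order of the entries matters.
mainTheorem3 : (m : ℕ) (T : Tableau m) → IsConstrainedYoung T → IsRealizable T
mainTheorem3 zero T _ = (λ _ → 0ℚ) , (λ ()) , refl , ℚP.≤-refl , (λ ()) , (λ ()) , λ _ ()
mainTheorem3 (suc n) T (_ , mono , columnsWeak , ties , rowTies)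
  with T zero zero ℕ.≟ T (suc zero) zero
... | yes tie =
  let b , realizesT = realizeEqualRows T mono (λ j → rowTies zero j tie)
  in realizable (λ _ → 0ℚ) b refl ℚP.≤-refl mono realizesT
... | no ¬tie =
  let b , realizesT = realizeStrict T mono strict ties
  in realizable unitGap b refl (unitGap-nonNeg (suc zero)) mono realizesT
  where
  strict : StrictColumns T
  strict j = ℕP.≤∧≢⇒< (columnsWeak j) (λ tie → ¬tie (rowTies j zero tie))
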